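{- Let $\mathcal{G}=(V,E,\mathcal{E})$ be an extended graph and let $u,v,w,x\in V$ satisfy $\deg(v)=\deg(u)=\deg(w)=2$, $N(v)=\{u,w\}$, $N^2(v)=\{x\}$, $x\in N(u)$ and $x\in N(w)$. Then $v$ is contained in some maximum 2-packing set of $\mathcal{G}$. Consequently, with $\mathcal{G}'=\mathcal{G}[V\setminus N^2[v]]$, we have $\beta(\mathcal{G})=\beta(\mathcal{G}')+1$.
   Context: Let $H=(V_H,E_H)$ be a finite simple undirected graph and let $\mathcal{E}_H$ be the set of unordered pairs $\{x,y\}$ of distinct vertices with $\{x,y\}\notin E_H$ that have a common neighbor in $H$. An extended graph $\mathcal{G}=(V,E,\mathcal{E})$ is obtained from such an $H$ by choosing $V\subseteq V_H$ and letting $E$ (resp. $\mathcal{E}$) be the pairs of $E_H$ (resp. $\mathcal{E}_H$) with both endpoints in $V$. For $U\subseteq V$, $\mathcal{G}[U]$ denotes the extended graph on $U$ keeping exactly the pairs of $E$ and of $\mathcal{E}$ with both endpoints in $U$. For $v\in V$: $N(v)=\{y:\{y,v\}\in E\}$, $N[v]=N(v)\cup\{v\}$, $\deg(v)=|N(v)|$, $N^2(v)=\{y:\{y,v\}\in\mathcal{E}\}$, $N^2[v]=N^2(v)\cup N[v]$. A 2-packing set of $\mathcal{G}$ is a set $S\subseteq V$ such that no two distinct vertices of $S$ form a pair in $E\cup\mathcal{E}$; a maximum 2-packing set is one of maximum cardinality, and $\beta(\mathcal{G})$ is this maximum cardinality. -}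

module Defs where

open import Data.Nat using (ℕ; suc; _≤_)
open import Data.Bool using (Bool; true; false; _∧_; _∨_; not; T)
open import Data.Fin using (Fin; zero; suc; _≟_)
open import Data.Fin.Subset using (Subset; _∈_; _⊆_; ∣_∣; _∪_; _∩_; ∁; ⁅_⁆)
open import Data.Vec using (tabulate; lookup)
open import Relation.Nullary.Decidable using (⌊_⌋)
open import Relation.Binary.PropositionalEquality using (_≡_; _≢_)
open import Data.Product using (_×_)

record SimpleGraph (n : ℕ) : Set where
  field
    adj    : Fin n → Fin n → Bool
    sym    : ∀ x y → adj x y ≡ adj y x
    irrefl : ∀ x → adj x x ≡ false
open SimpleGraph public

anyFin : ∀ {n} → (Fin n → Bool) → Bool
anyFin {ℕ.zero} f = false
anyFin {suc n} f = f zero ∨ anyFin (λ i → f (suc i))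

-- An extended graph: a simple graph H together with a chosen vertex set V ⊆ V_H.
-- E and 𝓔 are the pairs of E_H and 𝓔_H with both endpoints in V.
-- Taking an induced extended graph G[U] (U ⊆ V) corresponds to replacing V by U
-- (same H), since E and 𝓔 are just restricted to U.
record ExtGraph (n : ℕ) : Set where
  constructor ext
  field
    H : SimpleGraph n
    V : Subset n
open ExtGraph public

module _ {n : ℕ} (G : ExtGraph n) where
  private
    a = adj (H G)
    inV : Fin n → Bool
    inV y = lookup (V G) y

  isE : Fin n → Fin n → Bool
  isE x y = inV x ∧ inV y ∧ a x y

  -- {x,y} ∈ 𝓔 : distinct, non-adjacent in H, with a common neighbour in H
  -- (the common neighbour ranges over all of V_H), both endpoints in V
  is𝓔 : Fin n → Fin n → Bool
  is𝓔 x y = inV x ∧ inV y ∧ not ⌊ x ≟ y ⌋ ∧ not (a x y)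
            ∧ anyFin (λ z → a x z ∧ a z y)

  N : Fin n → Subset n
  N v = tabulate (λ y → isE y v)

  Nc : Fin n → Subset n
  Nc v = N v ∪ ⁅ v ⁆

  deg : Fin n → ℕ
  deg v = ∣ N v ∣

  N² : Fin n → Subset n
  N² v = tabulate (λ y → is𝓔 y v)

  N²c : Fin n → Subset n
  N²c v = N² v ∪ Nc v

  Is2Packing : Subset n → Set
  Is2Packing S = S ⊆ V G × (∀ x y → x ∈ S → y ∈ S → x ≢ y →
                   T (not (isE x y ∨ is𝓔 x y)))

  IsMax2Packing : Subset n → Set
  IsMax2Packing S = Is2Packing S × (∀ T′ → Is2Packing T′ → ∣ T′ ∣ ≤ ∣ S ∣)

induced : ∀ {n} → ExtGraph n → Subset n → ExtGraph n
induced G U = ext (H G) U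

{-# OPTIONS --safe #-}
-- The four vertices v, u, w, x of N²[v] pairwise conflict (lie in E ∪ 𝓔): u, w, x are within
-- distance two of v, x is adjacent to u and w, and u, w are distinct (deg v = 2), non-adjacent
-- (otherwise N(u) ⊇ {v, x, w} contradicts deg u = 2) and share the neighbour v. So a 2-packing
-- meets N²[v] at most once, whereas v conflicts with nothing outside N²[v]. Trading the vertex a
-- maximum 2-packing has in N²[v] for v, and adding v to a 2-packing of G[V ∖ N²[v]], both give
-- 2-packings of G; the two claims follow by comparing sizes.
module Submission where

open import Defs hiding (sym)
open import Algebra.Bundles using (CommutativeMonoid)
open import Data.Bool using (Bool; true; false; _∧_; _∨_; not; T)
open import Data.Bool.Properties using (T-≡; T-not-≡; T-∨; ∧-comm; ∧-commutativeMonoid)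
open import Algebra.Properties.CommutativeSemigroup
  (CommutativeMonoid.commutativeSemigroup ∧-commutativeMonoid) using (x∙yz≈y∙xz)
open import Data.Empty using (⊥-elim)
open import Data.Fin using (Fin; zero; suc; _≟_)
open import Data.Fin.Properties using (all?)
open import Data.Fin.Subset
  using (Subset; inside; outside; _∈_; _∉_; _⊆_; ∣_∣; _∪_; _∩_; _-_; ∁; ⁅_⁆) renaming (⊥ to ∅)
open import Data.Fin.Subset.Properties
  using ( nonempty?; _∈?_; _⊆?_; ∉⊥; x∈⁅x⁆; x∈⁅y⁆⇒x≡y; ∣⁅x⁆∣≡1; p⊆q⇒∣p∣≤∣q∣; p⊂q⇒∣p∣<∣q∣
        ; x∈∁p⇒x∉p; x∉p⇒x∈∁p; p∩q⊆p; x∈p∩q⁺; x∈p∩q⁻; ∪-assoc; ∪-idem; ∪-identityʳ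
        ; p⊆p∪q; q⊆p∪q; x∈p∪q⁺; x∈p∪q⁻; x∈p∧x≢y⇒x∈p-y; x∈p⇒∣p-x∣<∣p∣ )
open import Data.List using (List; []; _∷_; map; _++_; filter)
open import Data.List.Membership.Propositional using () renaming (_∈_ to _∈ˡ_)
open import Data.List.Membership.Propositional.Properties using (∈-++⁺ˡ; ∈-++⁺ʳ; ∈-map⁺; ∈-filter⁺)
open import Data.List.Relation.Unary.Any using (here)
open import Data.List.Relation.Unary.All using () renaming (lookup to lookupᴬ)
open import Data.List.Relation.Unary.All.Properties using (all-filter)
open import Data.Nat using (ℕ; suc; _≤_; _<_; s≤s; z≤n)
open import Data.Nat.Properties using (≤-refl; ≤-trans; ≤-antisym; n≤1+n; m≤n⇒m≤1+n; ≤-totalOrder)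
open import Data.List.Extrema ≤-totalOrder using (argmax; argmax-all; f[xs]≤f[argmax])
open import Data.Product using (_×_; ∃; _,_; proj₁; proj₂)
open import Data.Sum using (inj₁; inj₂)
open import Data.Unit using (tt)
open import Data.Vec using ([]; _∷_; lookup; tabulate)
open import Data.Vec.Properties using ([]=⇒lookup; lookup⇒[]=; lookup∘tabulate)
open import Function using (_∘_; Equivalence; mk⇔)
open import Relation.Binary.PropositionalEquality
  using (_≡_; _≢_; refl; sym; trans; cong; cong₂; subst; module ≡-Reasoning)
open import Relation.Nullary using (Dec; does; yes; no; ¬_; _×-dec_; _→-dec_; ¬?)
open import Relation.Nullary.Decidable using (⌊_⌋; T?; isYes≗does; does-⇔)
open import Relation.Unary using (Pred; Decidable)

open Equivalence using (to; from)

T-not⇒¬T : ∀ {b} → T (not b) → ¬ T b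
T-not⇒¬T {true} ()

¬T⇒T-not : ∀ {b} → ¬ T b → T (not b)
¬T⇒T-not {false} _ = tt
¬T⇒T-not {true} ¬t = ¬t tt

T-∧⁺ : ∀ {a b} → T a → T b → T (a ∧ b)
T-∧⁺ {true} _ tb = tb

∈⇒T-lookup : ∀ {n} {p : Subset n} {y} → y ∈ p → T (lookup p y)
∈⇒T-lookup y∈p = from T-≡ ([]=⇒lookup y∈p)

∈tabulate⁻ : ∀ {n} {f : Fin n → Bool} {y} → y ∈ tabulate f → T (f y)
∈tabulate⁻ {f = f} {y} y∈ = from T-≡ (trans (sym (lookup∘tabulate f y)) ([]=⇒lookup y∈))

∈tabulate⁺ : ∀ {n} {f : Fin n → Bool} {y} → T (f y) → y ∈ tabulate f
∈tabulate⁺ {f = f} {y} t = lookup⇒[]= y (tabulate f) (trans (lookup∘tabulate f y) (to T-≡ t))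

⌊≟⌋-sym : ∀ {n} (y z : Fin n) → ⌊ y ≟ z ⌋ ≡ ⌊ z ≟ y ⌋
⌊≟⌋-sym y z = begin
  ⌊ y ≟ z ⌋  ≡⟨ isYes≗does (y ≟ z) ⟩
  does (y ≟ z) ≡⟨ does-⇔ (mk⇔ sym sym) (y ≟ z) (z ≟ y) ⟩
  does (z ≟ y) ≡⟨ isYes≗does (z ≟ y) ⟨
  ⌊ z ≟ y ⌋  ∎
  where open ≡-Reasoning

anyFin⁺ : ∀ {n} (f : Fin n → Bool) i → T (f i) → T (anyFin f)
anyFin⁺ f zero    t = from T-∨ (inj₁ t)
anyFin⁺ f (suc i) t = from T-∨ (inj₂ (anyFin⁺ (f ∘ suc) i t))

anyFin-cong : ∀ {n} {f g : Fin n → Bool} → (∀ i → f i ≡ g i) → anyFin f ≡ anyFin g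
anyFin-cong {ℕ.zero} _   = refl
anyFin-cong {suc n}  f≗g = cong₂ _∨_ (f≗g zero) (anyFin-cong (f≗g ∘ suc))

∣p∪⁅x⁆∣≤1+∣p∣ : ∀ {n} (p : Subset n) x → ∣ p ∪ ⁅ x ⁆ ∣ ≤ suc ∣ p ∣
∣p∪⁅x⁆∣≤1+∣p∣ (outside ∷ p) zero    rewrite ∪-identityʳ p = ≤-refl
∣p∪⁅x⁆∣≤1+∣p∣ (inside  ∷ p) zero    rewrite ∪-identityʳ p = n≤1+n _
∣p∪⁅x⁆∣≤1+∣p∣ (outside ∷ p) (suc x) = ∣p∪⁅x⁆∣≤1+∣p∣ p x
∣p∪⁅x⁆∣≤1+∣p∣ (inside  ∷ p) (suc x) = s≤s (∣p∪⁅x⁆∣≤1+∣p∣ p x)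

∣p∣<∣p∪⁅x⁆∣ : ∀ {n} (p : Subset n) {x} → x ∉ p → ∣ p ∣ < ∣ p ∪ ⁅ x ⁆ ∣
∣p∣<∣p∪⁅x⁆∣ p {x} x∉p = p⊂q⇒∣p∣<∣q∣ (p⊆p∪q ⁅ x ⁆ , x , q⊆p∪q p ⁅ x ⁆ (x∈⁅x⁆ x) , x∉p)

3≤∣p∣ : ∀ {n} {p : Subset n} {x y z} → x ∈ p → y ∈ p → z ∈ p →
        x ≢ y → x ≢ z → y ≢ z → 3 ≤ ∣ p ∣
3≤∣p∣ {p = p} {x} {y} x∈p y∈p z∈p x≢y x≢z y≢z =
  ≤-trans (s≤s (≤-trans (s≤s 1≤∣p-x-y∣) ∣p-x-y∣<∣p-x∣)) (x∈p⇒∣p-x∣<∣p∣ x∈p)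
  where
  1≤∣p-x-y∣ : 1 ≤ ∣ p - x - y ∣
  1≤∣p-x-y∣ = ≤-trans (s≤s z≤n)
    (x∈p⇒∣p-x∣<∣p∣ (x∈p∧x≢y⇒x∈p-y (x∈p∧x≢y⇒x∈p-y z∈p (x≢z ∘ sym)) (y≢z ∘ sym)))
  ∣p-x-y∣<∣p-x∣ : ∣ p - x - y ∣ < ∣ p - x ∣
  ∣p-x-y∣<∣p-x∣ = x∈p⇒∣p-x∣<∣p∣ (x∈p∧x≢y⇒x∈p-y y∈p (x≢y ∘ sym))

subsets : ∀ n → List (Subset n)
subsets ℕ.zero = [] ∷ []
subsets (suc n) = map (inside ∷_) (subsets n) ++ map (outside ∷_) (subsets n)

∈-subsets : ∀ {n} (p : Subset n) → p ∈ˡ subsets n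
∈-subsets []                    = here refl
∈-subsets {suc n} (inside  ∷ p) = ∈-++⁺ˡ (∈-map⁺ (inside ∷_) (∈-subsets p))
∈-subsets {suc n} (outside ∷ p) =
  ∈-++⁺ʳ (map (inside ∷_) (subsets n)) (∈-map⁺ (outside ∷_) (∈-subsets p))

∃-maximum : ∀ {n ℓ} {P : Pred (Subset n) ℓ} → Decidable P → P ∅ →
            ∃ λ S → P S × (∀ S′ → P S′ → ∣ S′ ∣ ≤ ∣ S ∣)
∃-maximum {n} {P = P} P? P∅ =
  S , argmax-all ∣_∣ P∅ (all-filter P? (subsets n)) ,
  λ S′ PS′ → lookupᴬ (f[xs]≤f[argmax] ∅ candidates) (∈-filter⁺ P? (∈-subsets S′) PS′)
  where
  candidates : List (Subset n)
  candidates = filter P? (subsets n)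
  S : Subset n
  S = argmax ∣_∣ ∅ candidates

module _ {n : ℕ} (G : ExtGraph n) where

  conflict : Fin n → Fin n → Bool
  conflict y z = isE G y z ∨ is𝓔 G y z

  isE-sym : ∀ y z → isE G y z ≡ isE G z y
  isE-sym y z rewrite SimpleGraph.sym (H G) y z = x∙yz≈y∙xz (lookup (V G) y) (lookup (V G) z) _

  commonNeighbour-sym : ∀ y z c → adj (H G) y c ∧ adj (H G) c z ≡ adj (H G) z c ∧ adj (H G) c y
  commonNeighbour-sym y z c =
    trans (cong₂ _∧_ (SimpleGraph.sym (H G) y c) (SimpleGraph.sym (H G) c z))
          (∧-comm (adj (H G) c y) (adj (H G) z c))

  is𝓔-sym : ∀ y z → is𝓔 G y z ≡ is𝓔 G z y
  is𝓔-sym y z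
    rewrite SimpleGraph.sym (H G) y z | ⌊≟⌋-sym y z | anyFin-cong (commonNeighbour-sym y z)
    = x∙yz≈y∙xz (lookup (V G) y) (lookup (V G) z) _

  conflict-sym : ∀ y z → conflict y z ≡ conflict z y
  conflict-sym y z = cong₂ _∨_ (isE-sym y z) (is𝓔-sym y z)

  isE⇒conflict : ∀ {y z} → T (isE G y z) → T (conflict y z)
  isE⇒conflict = from T-∨ ∘ inj₁

  is𝓔⇒conflict : ∀ {y z} → T (is𝓔 G y z) → T (conflict y z)
  is𝓔⇒conflict = from T-∨ ∘ inj₂

  isE⁻ : ∀ {y z} → T (isE G y z) → y ∈ V G × z ∈ V G × T (adj (H G) y z)
  isE⁻ {y} {z} e with lookup (V G) y in y∈V | lookup (V G) z in z∈V
  ... | true  | true  = lookup⇒[]= y (V G) y∈V , lookup⇒[]= z (V G) z∈V , e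
  ... | true  | false = ⊥-elim e
  ... | false | _     = ⊥-elim e

  isE⇒adj : ∀ {y z} → T (isE G y z) → T (adj (H G) y z)
  isE⇒adj e = proj₂ (proj₂ (isE⁻ e))

  adj⇒isE : ∀ {y z} → y ∈ V G → z ∈ V G → T (adj (H G) y z) → T (isE G y z)
  adj⇒isE y∈V z∈V a = T-∧⁺ (∈⇒T-lookup y∈V) (T-∧⁺ (∈⇒T-lookup z∈V) a)

  isE⇒≢ : ∀ {y z} → T (isE G y z) → y ≢ z
  isE⇒≢ {y} e refl = subst T (SimpleGraph.irrefl (H G) y) (isE⇒adj e)

  is𝓔⁻ : ∀ {y z} → T (is𝓔 G y z) → y ≢ z × ¬ T (adj (H G) y z)
  is𝓔⁻ {y} {z} e with lookup (V G) y | lookup (V G) z | y ≟ z | adj (H G) y z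
  ... | true  | true  | no y≢z | false = y≢z , λ ()
  ... | true  | true  | no _   | true  = ⊥-elim e
  ... | true  | true  | yes _  | _     = ⊥-elim e
  ... | true  | false | _      | _     = ⊥-elim e
  ... | false | _     | _      | _     = ⊥-elim e

  is𝓔-intro : ∀ {y z c} → y ≢ z → ¬ T (adj (H G) y z) →
              T (isE G y c) → T (isE G c z) → T (is𝓔 G y z)
  is𝓔-intro {y} {z} {c} y≢z ¬yz yc cz with y ≟ z
  ... | yes y≡z = ⊥-elim (y≢z y≡z)
  ... | no _
    rewrite []=⇒lookup (proj₁ (isE⁻ yc)) | []=⇒lookup (proj₁ (proj₂ (isE⁻ cz)))
          | to T-not-≡ (¬T⇒T-not ¬yz)
    = anyFin⁺ (λ k → adj (H G) y k ∧ adj (H G) k z) c (T-∧⁺ (isE⇒adj yc) (isE⇒adj cz))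

  ∈N⇒isE : ∀ {y z} → y ∈ N G z → T (isE G y z)
  ∈N⇒isE = ∈tabulate⁻

  isE⇒∈N : ∀ {y z} → T (isE G y z) → y ∈ N G z
  isE⇒∈N = ∈tabulate⁺

  ∈N²⇒is𝓔 : ∀ {y z} → y ∈ N² G z → T (is𝓔 G y z)
  ∈N²⇒is𝓔 = ∈tabulate⁻

  conflict⇒∈N²c : ∀ {y z} → T (conflict y z) → y ∈ N²c G z
  conflict⇒∈N²c c with to T-∨ c
  ... | inj₁ e = x∈p∪q⁺ (inj₂ (x∈p∪q⁺ (inj₁ (isE⇒∈N e))))
  ... | inj₂ f = x∈p∪q⁺ (inj₁ (∈tabulate⁺ f))

  ∈N²∪N⇒conflict : ∀ {y z} → y ∈ N² G z ∪ N G z → T (conflict y z)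
  ∈N²∪N⇒conflict {z = z} y∈ with x∈p∪q⁻ (N² G z) (N G z) y∈
  ... | inj₁ y∈N² = is𝓔⇒conflict (∈N²⇒is𝓔 y∈N²)
  ... | inj₂ y∈N  = isE⇒conflict (∈N⇒isE y∈N)

module _ {n : ℕ} (G : ExtGraph n) where

  IsConflictClique : Subset n → Set
  IsConflictClique C = ∀ y z → y ∈ C → z ∈ C → y ≢ z → T (conflict G y z)

  ⁅⁆-isConflictClique : ∀ c → IsConflictClique ⁅ c ⁆
  ⁅⁆-isConflictClique c y z y∈ z∈ y≢z =
    ⊥-elim (y≢z (trans (x∈⁅y⁆⇒x≡y c y∈) (sym (x∈⁅y⁆⇒x≡y c z∈))))

  ∪⁅⁆-isConflictClique : ∀ {C c} → IsConflictClique C → (∀ {y} → y ∈ C → T (conflict G y c)) →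
                         IsConflictClique (C ∪ ⁅ c ⁆)
  ∪⁅⁆-isConflictClique {C} {c} C-clique C-c y z y∈ z∈ y≢z
    with x∈p∪q⁻ C ⁅ c ⁆ y∈ | x∈p∪q⁻ C ⁅ c ⁆ z∈
  ... | inj₁ y∈C | inj₁ z∈C = C-clique y z y∈C z∈C y≢z
  ... | inj₁ y∈C | inj₂ z∈c rewrite x∈⁅y⁆⇒x≡y c z∈c = C-c y∈C
  ... | inj₂ y∈c | inj₁ z∈C rewrite x∈⁅y⁆⇒x≡y c y∈c | conflict-sym G c z = C-c z∈C
  ... | inj₂ y∈c | inj₂ z∈c = ⁅⁆-isConflictClique c y z y∈c z∈c y≢z

  IsSimplicial : Fin n → Set
  IsSimplicial v = IsConflictClique (N²c G v)

  N²∪N-clique⇒simplicial : ∀ {v} → IsConflictClique (N² G v ∪ N G v) → IsSimplicial v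
  N²∪N-clique⇒simplicial {v} clique =
    subst IsConflictClique (∪-assoc (N² G v) (N G v) ⁅ v ⁆)
      (∪⁅⁆-isConflictClique clique (∈N²∪N⇒conflict G))

  is2Packing? : ∀ S → Dec (Is2Packing G S)
  is2Packing? S = (S ⊆? V G) ×-dec all? (λ y → all? (λ z →
    (y ∈? S) →-dec ((z ∈? S) →-dec (¬? (y ≟ z) →-dec T? (not (conflict G y z))))))

  ∅-is2Packing : Is2Packing G ∅
  ∅-is2Packing = ⊥-elim ∘ ∉⊥ , λ _ _ y∈∅ → ⊥-elim (∉⊥ y∈∅)

  ∃-max2Packing : ∃ (IsMax2Packing G)
  ∃-max2Packing = ∃-maximum is2Packing? ∅-is2Packing

  is2Packing-⊆ : ∀ {S S′} → S′ ⊆ S → Is2Packing G S → Is2Packing G S′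
  is2Packing-⊆ S′⊆S (S⊆V , S-pack) =
    S⊆V ∘ S′⊆S , λ y z y∈ z∈ → S-pack y z (S′⊆S y∈) (S′⊆S z∈)

  is2Packing-∪⁅⁆ : ∀ {S v} → v ∈ V G → Is2Packing G S → (∀ {y} → y ∈ S → y ∉ N²c G v) →
                   Is2Packing G (S ∪ ⁅ v ⁆)
  is2Packing-∪⁅⁆ {S} {v} v∈V (S⊆V , S-pack) S-far = ⊆V , pack
    where
    far⇒¬conflict : ∀ {y} → y ∈ S → T (not (conflict G y v))
    far⇒¬conflict y∈S = ¬T⇒T-not (S-far y∈S ∘ conflict⇒∈N²c G)
    ⊆V : S ∪ ⁅ v ⁆ ⊆ V G
    ⊆V y∈ with x∈p∪q⁻ S ⁅ v ⁆ y∈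
    ... | inj₁ y∈S = S⊆V y∈S
    ... | inj₂ y∈v rewrite x∈⁅y⁆⇒x≡y v y∈v = v∈V
    pack : ∀ y z → y ∈ S ∪ ⁅ v ⁆ → z ∈ S ∪ ⁅ v ⁆ → y ≢ z → T (not (conflict G y z))
    pack y z y∈ z∈ y≢z with x∈p∪q⁻ S ⁅ v ⁆ y∈ | x∈p∪q⁻ S ⁅ v ⁆ z∈
    ... | inj₁ y∈S | inj₁ z∈S = S-pack y z y∈S z∈S y≢z
    ... | inj₁ y∈S | inj₂ z∈v rewrite x∈⁅y⁆⇒x≡y v z∈v = far⇒¬conflict y∈S
    ... | inj₂ y∈v | inj₁ z∈S rewrite x∈⁅y⁆⇒x≡y v y∈v | conflict-sym G v z = far⇒¬conflict z∈S
    ... | inj₂ y∈v | inj₂ z∈v = ⊥-elim (y≢z (trans (x∈⁅y⁆⇒x≡y v y∈v) (sym (x∈⁅y⁆⇒x≡y v z∈v))))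

  ∣S∣≤1+∣S∖C∣ : ∀ {C S} → IsConflictClique C → Is2Packing G S → ∣ S ∣ ≤ suc ∣ S ∩ ∁ C ∣
  ∣S∣≤1+∣S∖C∣ {C} {S} C-clique (_ , S-pack) with nonempty? (S ∩ C)
  ... | no S∩C-empty = m≤n⇒m≤1+n (p⊆q⇒∣p∣≤∣q∣ λ {y} y∈S →
          x∈p∩q⁺ (y∈S , x∉p⇒x∈∁p λ y∈C → S∩C-empty (y , x∈p∩q⁺ (y∈S , y∈C))))
  ... | yes (c , c∈S∩C) =
          ≤-trans (p⊆q⇒∣p∣≤∣q∣ S⊆) (∣p∪⁅x⁆∣≤1+∣p∣ (S ∩ ∁ C) c)
    where
    S⊆ : S ⊆ (S ∩ ∁ C) ∪ ⁅ c ⁆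
    S⊆ {y} y∈S with y ∈? C | y ≟ c
    ... | no y∉C | _      = x∈p∪q⁺ (inj₁ (x∈p∩q⁺ (y∈S , x∉p⇒x∈∁p y∉C)))
    ... | yes _  | yes refl = x∈p∪q⁺ (inj₂ (x∈⁅x⁆ c))
    ... | yes y∈C | no y≢c = ⊥-elim (T-not⇒¬T (S-pack y c y∈S (proj₁ c∈SC) y≢c)
                                              (C-clique y c y∈C (proj₂ c∈SC) y≢c))
      where
      c∈SC : c ∈ S × c ∈ C
      c∈SC = x∈p∩q⁻ S C c∈S∩C

  conflict-induced : ∀ {U y z} → y ∈ U → z ∈ U → y ∈ V G → z ∈ V G →
                     conflict (induced G U) y z ≡ conflict G y z
  conflict-induced y∈U z∈U y∈V z∈V
    rewrite []=⇒lookup y∈U | []=⇒lookup z∈U | []=⇒lookup y∈V | []=⇒lookup z∈V = refl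

  is2Packing-induced⁺ : ∀ {U S} → S ⊆ U → Is2Packing G S → Is2Packing (induced G U) S
  is2Packing-induced⁺ S⊆U (S⊆V , S-pack) = S⊆U , λ y z y∈ z∈ y≢z →
    subst (T ∘ not) (sym (conflict-induced (S⊆U y∈) (S⊆U z∈) (S⊆V y∈) (S⊆V z∈)))
      (S-pack y z y∈ z∈ y≢z)

  is2Packing-induced⁻ : ∀ {U S} → U ⊆ V G → Is2Packing (induced G U) S → Is2Packing G S
  is2Packing-induced⁻ U⊆V (S⊆U , S-pack) = U⊆V ∘ S⊆U , λ y z y∈ z∈ y≢z →
    subst (T ∘ not) (conflict-induced (S⊆U y∈) (S⊆U z∈) (U⊆V (S⊆U y∈)) (U⊆V (S⊆U z∈)))
      (S-pack y z y∈ z∈ y≢z)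

v∈N²[v] : ∀ {n} (G : ExtGraph n) v → v ∈ N²c G v
v∈N²[v] G v = x∈p∪q⁺ (inj₂ (x∈p∪q⁺ (inj₂ (x∈⁅x⁆ v))))

∈∩∁⇒∉ : ∀ {n} {p q : Subset n} {y} → y ∈ p ∩ ∁ q → y ∉ q
∈∩∁⇒∉ {p = p} {q} y∈ = x∈∁p⇒x∉p (proj₂ (x∈p∩q⁻ p (∁ q) y∈))

module _ {n : ℕ} (G : ExtGraph n) {v : Fin n} (v∈V : v ∈ V G)
         (simplicial : IsSimplicial G v) where

  private
    C : Subset n
    C = N²c G v

  simplicial⇒∈max2Packing : ∃ λ S → IsMax2Packing G S × v ∈ S
  simplicial⇒∈max2Packing with ∃-max2Packing G
  ... | S₀ , S₀-pack , S₀-max =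
    S , (S-pack , λ S′ S′-pack → ≤-trans (S₀-max S′ S′-pack) ∣S₀∣≤∣S∣) , x∈p∪q⁺ (inj₂ (x∈⁅x⁆ v))
    where
    S = (S₀ ∩ ∁ C) ∪ ⁅ v ⁆
    S-pack : Is2Packing G S
    S-pack = is2Packing-∪⁅⁆ G v∈V (is2Packing-⊆ G (p∩q⊆p S₀ (∁ C)) S₀-pack) ∈∩∁⇒∉
    ∣S₀∣≤∣S∣ : ∣ S₀ ∣ ≤ ∣ S ∣
    ∣S₀∣≤∣S∣ = ≤-trans (∣S∣≤1+∣S∖C∣ G simplicial S₀-pack)
                       (∣p∣<∣p∪⁅x⁆∣ (S₀ ∩ ∁ C) λ v∈ → ∈∩∁⇒∉ v∈ (v∈N²[v] G v))

  simplicial⇒β≡1+β′ : ∀ S S′ → IsMax2Packing G S →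
                      IsMax2Packing (induced G (V G ∩ ∁ C)) S′ → ∣ S ∣ ≡ suc ∣ S′ ∣
  simplicial⇒β≡1+β′ S S′ (S-pack , S-max) (S′-pack , S′-max) = ≤-antisym ∣S∣≤1+∣S′∣ 1+∣S′∣≤∣S∣
    where
    S∖C-pack : Is2Packing (induced G (V G ∩ ∁ C)) (S ∩ ∁ C)
    S∖C-pack = is2Packing-induced⁺ G
      (λ y∈ → let y∈S , y∈∁C = x∈p∩q⁻ S (∁ C) y∈ in x∈p∩q⁺ (proj₁ S-pack y∈S , y∈∁C))
      (is2Packing-⊆ G (p∩q⊆p S (∁ C)) S-pack)
    S′∪v-pack : Is2Packing G (S′ ∪ ⁅ v ⁆)
    S′∪v-pack = is2Packing-∪⁅⁆ G v∈V (is2Packing-induced⁻ G (p∩q⊆p (V G) (∁ C)) S′-pack)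
                  (∈∩∁⇒∉ ∘ proj₁ S′-pack)
    ∣S∣≤1+∣S′∣ : ∣ S ∣ ≤ suc ∣ S′ ∣
    ∣S∣≤1+∣S′∣ = ≤-trans (∣S∣≤1+∣S∖C∣ G simplicial S-pack) (s≤s (S′-max _ S∖C-pack))
    1+∣S′∣≤∣S∣ : suc ∣ S′ ∣ ≤ ∣ S ∣
    1+∣S′∣≤∣S∣ = ≤-trans (∣p∣<∣p∪⁅x⁆∣ S′ λ v∈S′ → ∈∩∁⇒∉ (proj₁ S′-pack v∈S′) (v∈N²[v] G v))
                         (S-max _ S′∪v-pack)

deg≡2⇒distinct : ∀ {n} (G : ExtGraph n) {v u w} → deg G v ≡ 2 → N G v ≡ ⁅ u ⁆ ∪ ⁅ w ⁆ → u ≢ w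
deg≡2⇒distinct G {v} {u} deg-v N-v refl = 1≢2 (begin
  1                  ≡⟨ sym (∣⁅x⁆∣≡1 u) ⟩
  ∣ ⁅ u ⁆ ∣          ≡⟨ cong ∣_∣ (sym (∪-idem ⁅ u ⁆)) ⟩
  ∣ ⁅ u ⁆ ∪ ⁅ u ⁆ ∣  ≡⟨ cong ∣_∣ (sym N-v) ⟩
  deg G v            ≡⟨ deg-v ⟩
  2                  ∎)
  where
  open ≡-Reasoning
  1≢2 : 1 ≢ 2
  1≢2 ()

fourCycle⇒simplicial :
  ∀ {n} (G : ExtGraph n) {u v w x} →
  deg G v ≡ 2 → deg G u ≡ 2 → N G v ≡ ⁅ u ⁆ ∪ ⁅ w ⁆ → N² G v ≡ ⁅ x ⁆ →
  x ∈ N G u → x ∈ N G w → IsSimplicial G v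
fourCycle⇒simplicial G {u} {v} {w} {x} deg-v deg-u N-v N²-v x∈N-u x∈N-w =
  N²∪N-clique⇒simplicial G
    (subst (IsConflictClique G) (trans (∪-assoc ⁅ x ⁆ ⁅ u ⁆ ⁅ w ⁆) (sym (cong₂ _∪_ N²-v N-v)))
      (∪⁅⁆-isConflictClique G (∪⁅⁆-isConflictClique G (⁅⁆-isConflictClique G x) x⇝u) xu⇝w))
  where
  uv : T (isE G u v)
  uv = ∈N⇒isE G (subst (u ∈_) (sym N-v) (x∈p∪q⁺ (inj₁ (x∈⁅x⁆ u))))
  wv : T (isE G w v)
  wv = ∈N⇒isE G (subst (w ∈_) (sym N-v) (x∈p∪q⁺ (inj₂ (x∈⁅x⁆ w))))
  xv : T (is𝓔 G x v)
  xv = ∈N²⇒is𝓔 G (subst (x ∈_) (sym N²-v) (x∈⁅x⁆ x))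
  x≢w : x ≢ w
  x≢w refl = proj₂ (is𝓔⁻ G xv) (isE⇒adj G wv)
  ¬adj-uw : ¬ T (adj (H G) u w)
  ¬adj-uw adj-uw = 3≰2 (subst (3 ≤_) deg-u
      (3≤∣p∣ v∈N-u x∈N-u w∈N-u (proj₁ (is𝓔⁻ G xv) ∘ sym) (isE⇒≢ G wv ∘ sym) x≢w))
    where
    3≰2 : ¬ 3 ≤ 2
    3≰2 (s≤s (s≤s ()))
    v∈N-u : v ∈ N G u
    v∈N-u = isE⇒∈N G (subst T (isE-sym G u v) uv)
    w∈N-u : w ∈ N G u
    w∈N-u = isE⇒∈N G (adj⇒isE G (proj₁ (isE⁻ G wv)) (proj₁ (isE⁻ G uv))
                                 (subst T (SimpleGraph.sym (H G) u w) adj-uw))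
  uw : T (is𝓔 G u w)
  uw = is𝓔-intro G (deg≡2⇒distinct G deg-v N-v) ¬adj-uw uv (subst T (isE-sym G w v) wv)
  x⇝u : ∀ {y} → y ∈ ⁅ x ⁆ → T (conflict G y u)
  x⇝u y∈ rewrite x∈⁅y⁆⇒x≡y x y∈ = isE⇒conflict G (∈N⇒isE G x∈N-u)
  xu⇝w : ∀ {y} → y ∈ ⁅ x ⁆ ∪ ⁅ u ⁆ → T (conflict G y w)
  xu⇝w {y} y∈ with x∈p∪q⁻ ⁅ x ⁆ ⁅ u ⁆ y∈
  ... | inj₁ y∈x rewrite x∈⁅y⁆⇒x≡y x y∈x = isE⇒conflict G (∈N⇒isE G x∈N-w)
  ... | inj₂ y∈u rewrite x∈⁅y⁆⇒x≡y u y∈u = is𝓔⇒conflict G uw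

mainTheorem9 : ∀ {n} (G : ExtGraph n) (u v w x : Fin n) →
    u ∈ V G → v ∈ V G → w ∈ V G → x ∈ V G →
    deg G v ≡ 2 → deg G u ≡ 2 → deg G w ≡ 2 →
    N G v ≡ ⁅ u ⁆ ∪ ⁅ w ⁆ →
    N² G v ≡ ⁅ x ⁆ →
    x ∈ N G u → x ∈ N G w →
    (∃ λ S → IsMax2Packing G S × v ∈ S)
    × (∀ S S′ → IsMax2Packing G S →
         IsMax2Packing (induced G (V G ∩ ∁ (N²c G v))) S′ →
         ∣ S ∣ ≡ suc ∣ S′ ∣)
-- deg w ≡ 2 is redundant: deg u ≡ 2 alone forces u and w to be non-adjacent.
mainTheorem9 G u v w x _ v∈V _ _ deg-v deg-u _ N-v N²-v x∈N-u x∈N-w =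
  simplicial⇒∈max2Packing G v∈V simplicial , simplicial⇒β≡1+β′ G v∈V simplicial
  where
  simplicial : IsSimplicial G v
  simplicial = fourCycle⇒simplicial G deg-v deg-u N-v N²-v x∈N-u x∈N-w
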